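{- If $n\geq 2$ is even, then $$\left(\frac{12B_{\frac{n+2}{2}}^{neobc}-4C_{\frac{n+2}{2}}^{neobc}-6}{6},\ \frac{12B_{\frac{n+2}{2}}^{neobc}-4C_{\frac{n+2}{2}}^{neobc}-12}{6},\ \frac{ -16B_{\frac{n+2}{2}}^{neobc}+6C_{\frac{n+2}{2}}^{neobc}+12}{6}\right)$$ is a Pythagorean triple, and if $n\geq1$ is odd, then $(a,b,c)$ is a Pythagorean triple, where $$a=\frac{20B_{\frac{n+3}{2}}^{neobc}+4B_{\frac{n+1}{2}}^{neobc}-7C_{\frac{n+3}{2}}^{neobc}-C_{\frac{n+1}{2}}^{neobc}-12}{12},$$ $$b=\frac{20B_{\frac{n+3}{2}}^{neobc}+4B_{\frac{n+1}{2}}^{neobc}-7C_{\frac{n+3}{2}}^{neobc}-C_{\frac{n+1}{2}}^{neobc}-24}{12},$$ $$c=\frac{20B_{\frac{n+3}{2}}^{neobc}-4B_{\frac{n+1}{2}}^{neobc}-7C_{\frac{n+3}{2}}^{neobc}+C_{\frac{n+1}{2}}^{neobc}-12}{6}.$$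
   Context: A Pythagorean triple is a triple $(a,b,c)$ of positive integers with $a^2+b^2=c^2$. A positive integer $m$ is a neo balcobalancing number if there is a positive integer $r$ such that $(1+2+\cdots+(m-1))+(1+2+\cdots+m)=2[(m-1)+m+(m+1)+(m+2)+\cdots+(m+r)]$ (equivalently, $8m^2-12m+9$ is a perfect square). $B_k^{neobc}$ is the $k$-th neo balcobalancing number in increasing order ($k\ge1$) and $C_k^{neobc}=\sqrt{8(B_k^{neobc})^2-12B_k^{neobc}+9}$. -}

module Defs where

open import Data.Nat using (ℕ; zero; suc; _+_; _*_; _∸_; _<_; _≤_)
open import Data.Integer as ℤ using (ℤ; +_)
open import Data.Product using (Σ; ∃; _×_)
open import Relation.Binary.PropositionalEquality using (_≡_)
open import Relation.Nullary using (¬_)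

tri : ℕ → ℕ
tri zero = 0
tri (suc m) = suc m + tri m

sumFrom : ℕ → ℕ → ℕ
sumFrom a zero = 0
sumFrom a (suc l) = a + sumFrom (suc a) l

NeoBC : ℕ → Set
NeoBC m = (1 ≤ m) × ∃ λ r → (1 ≤ r) × (tri (m ∸ 1) + tri m ≡ 2 * sumFrom (m ∸ 1) (r + 2))

data NthNeoBC : ℕ → ℕ → Set where
  first : ∀ {m} → NeoBC m → (∀ j → j < m → ¬ NeoBC j) → NthNeoBC 1 m
  next  : ∀ {k m m′} → NthNeoBC k m → m < m′ → NeoBC m′
        → (∀ j → m < j → j < m′ → ¬ NeoBC j) → NthNeoBC (suc k) m′

PythagoreanTriple : ℤ → ℤ → ℤ → Set
PythagoreanTriple a b c =
  (ℤ.+0 ℤ.< a) × (ℤ.+0 ℤ.< b) × (ℤ.+0 ℤ.< c) × (a ℤ.* a ℤ.+ b ℤ.* b ≡ c ℤ.* c)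

PythagoreanQuot : ℤ → ℤ → ℤ → ℤ → ℤ → ℤ → Set
PythagoreanQuot dx x dy y dz z =
  Σ ℤ λ a → Σ ℤ λ b → Σ ℤ λ c →
    (dx ℤ.* a ≡ x) × (dy ℤ.* b ≡ y) × (dz ℤ.* c ≡ z) × PythagoreanTriple a b c

-- If m is neo balcobalancing with witness r, then (x, y) = (4m − 3, 2m + 2r + 1) solves
-- x² + 9 = 2y², and y = √(8m² − 12m + 9).  Every solution of this equation in ℕ descends along
-- (x, y) ↦ (3x − 4y, 3y − 2x) to (3, 3), so the solutions are the orbit of (3, 3) under
-- (x, y) ↦ (3x + 4y, 2x + 3y); the condition x ≡ 1 (mod 4) selects the odd-indexed terms.
-- This gives B_k = 6u_k and C_k = 12(u_k + w_k) + 3 for an explicit linear recurrence (u, w) with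
-- 2u² = (2w + 1)(2u + w).  In these coordinates every claimed quotient is a natural number linear
-- in (u, w), and the Pythagorean relation is that invariant in disguise.
module Submission where

open import Data.Empty using (⊥-elim)
open import Data.Fin using (Fin; toℕ; fromℕ<)
open import Data.Fin.Properties using (all?; toℕ-fromℕ<)
open import Data.Integer as ℤ using (ℤ; +_; _-_)
open import Data.Integer.Properties using (pos-*)
import Data.Integer.Tactic.RingSolver as ℤ-Solver
open import Data.List using (_∷_; [])
open import Data.Nat using (ℕ; zero; suc; _+_; _*_; _∸_; _≤_; _<_; _/_; z≤n; s≤s; z<s; _≟_; _≤?_)
open import Data.Nat.Divisibility using (_∣_; divides)
open import Data.Nat.DivMod using (m*n/n≡m)
open import Data.Nat.Induction using (<-rec)
open import Data.Nat.Properties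
open import Data.Nat.Tactic.RingSolver using (solve-∀; solve)
open import Data.Product using (∃; ∃₂; _×_; _,_; proj₁)
open import Data.Sum using (_⊎_; inj₁; inj₂)
open import Relation.Binary.Definitions using (tri<; tri≈; tri>)
open import Relation.Binary.PropositionalEquality
open import Relation.Nullary using (¬_; yes; no)
open import Relation.Nullary.Decidable using (_→-dec_; _×-dec_; toWitness)

open import Defs

m*m≤n*n⇒m≤n : ∀ {m n} → m * m ≤ n * n → m ≤ n
m*m≤n*n⇒m≤n sq = ≮⇒≥ λ n<m → <⇒≱ (*-mono-< n<m n<m) sq

m*m<n*n⇒m<n : ∀ {m n} → m * m < n * n → m < n
m*m<n*n⇒m<n sq = ≰⇒> λ n≤m → <⇒≱ sq (*-mono-≤ n≤m n≤m)

m*m≡n*n⇒m≡n : ∀ {m n} → m * m ≡ n * n → m ≡ n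
m*m≡n*n⇒m≡n sq = ≤-antisym (m*m≤n*n⇒m≤n (≤-reflexive sq)) (m*m≤n*n⇒m≤n (≤-reflexive (sym sq)))

m*4+1≢n*4+3 : ∀ m n → m * 4 + 1 ≢ n * 4 + 3
m*4+1≢n*4+3 zero    zero    ()
m*4+1≢n*4+3 zero    (suc n) ()
m*4+1≢n*4+3 (suc m) zero    ()
m*4+1≢n*4+3 (suc m) (suc n) e = m*4+1≢n*4+3 m n (suc-injective (suc-injective (suc-injective (suc-injective e))))

even⊎odd : ∀ n → ∃ λ t → n ≡ t * 2 ⊎ n ≡ suc (t * 2)
even⊎odd zero = 0 , inj₁ refl
even⊎odd (suc n) with even⊎odd n
... | t , inj₁ refl = t , inj₂ refl
... | t , inj₂ refl = suc t , inj₁ refl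

tri-closedForm : ∀ n → 2 * tri n ≡ n * suc n
tri-closedForm zero = refl
tri-closedForm (suc n) = begin
  2 * (suc n + tri n)    ≡⟨ *-distribˡ-+ 2 (suc n) (tri n) ⟩
  2 * suc n + 2 * tri n  ≡⟨ cong (_+_ (2 * suc n)) (tri-closedForm n) ⟩
  2 * suc n + n * suc n  ≡⟨ solve (n ∷ []) ⟩
  suc n * suc (suc n)    ∎
  where open ≡-Reasoning

tri+tri≡square : ∀ m → tri m + tri (suc m) ≡ suc m * suc m
tri+tri≡square m = begin
  tri m + (suc m + tri m)  ≡⟨ regroup m (tri m) ⟩
  suc m + 2 * tri m        ≡⟨ cong (_+_ (suc m)) (tri-closedForm m) ⟩
  suc m + m * suc m        ∎
  where
  open ≡-Reasoning
  regroup : ∀ m t → t + (suc m + t) ≡ suc m + 2 * t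
  regroup = solve-∀

sumFrom-closedForm : ∀ a l → 2 * sumFrom a l + l ≡ l * (2 * a + l)
sumFrom-closedForm a zero = refl
sumFrom-closedForm a (suc l) = begin
  2 * (a + sumFrom (suc a) l) + suc l      ≡⟨ regroup a l (sumFrom (suc a) l) ⟩
  2 * a + 1 + (2 * sumFrom (suc a) l + l)  ≡⟨ cong (_+_ (2 * a + 1)) (sumFrom-closedForm (suc a) l) ⟩
  2 * a + 1 + l * (2 * suc a + l)          ≡⟨ solve (a ∷ l ∷ []) ⟩
  suc l * (2 * a + suc l)                  ∎
  where
  open ≡-Reasoning
  regroup : ∀ a l s → 2 * (a + s) + suc l ≡ 2 * a + 1 + (2 * s + l)
  regroup = solve-∀

neoBC-equation⇒ : ∀ m L → tri m + tri (suc m) ≡ 2 * sumFrom m L → suc m * suc m + L ≡ L * (2 * m + L)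
neoBC-equation⇒ m L e = begin
  suc m * suc m + L    ≡⟨ cong (_+ L) (trans (sym (tri+tri≡square m)) e) ⟩
  2 * sumFrom m L + L  ≡⟨ sumFrom-closedForm m L ⟩
  L * (2 * m + L)      ∎
  where open ≡-Reasoning

neoBC-equation⇐ : ∀ m L → suc m * suc m + L ≡ L * (2 * m + L) → tri m + tri (suc m) ≡ 2 * sumFrom m L
neoBC-equation⇐ m L e = begin
  tri m + tri (suc m)  ≡⟨ tri+tri≡square m ⟩
  suc m * suc m        ≡⟨ +-cancelʳ-≡ L _ _ (trans e (sym (sumFrom-closedForm m L))) ⟩
  2 * sumFrom m L      ∎
  where open ≡-Reasoning

-- The equation x² + 9 = 2y²

PellSolution : ℕ → ℕ → Set
PellSolution x y = x * x + 9 ≡ 2 * (y * y)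

pellX pellY : ℕ → ℕ
pellX zero    = 3
pellX (suc j) = 3 * pellX j + 4 * pellY j
pellY zero    = 3
pellY (suc j) = 2 * pellX j + 3 * pellY j

pellSolution-descends : ∀ a b → PellSolution (3 * a + 4 * b) (2 * a + 3 * b) → PellSolution a b
pellSolution-descends a b e = +-cancelʳ-≡ (8 * (a * a) + 24 * (a * b) + 16 * (b * b)) _ _ (begin
  a * a + 9 + (8 * (a * a) + 24 * (a * b) + 16 * (b * b))  ≡⟨ solve (a ∷ b ∷ []) ⟩
  (3 * a + 4 * b) * (3 * a + 4 * b) + 9                    ≡⟨ e ⟩
  2 * ((2 * a + 3 * b) * (2 * a + 3 * b))                  ≡⟨ solve (a ∷ b ∷ []) ⟩
  2 * (b * b) + (8 * (a * a) + 24 * (a * b) + 16 * (b * b)) ∎)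
  where open ≡-Reasoning

pellSolution-small : ∀ {x y} → y ≤ 6 → PellSolution x y → x ≡ 3 × y ≡ 3
pellSolution-small {x} {y} y≤6 e =
  subst₂ (λ i j → PellSolution i j → i ≡ 3 × j ≡ 3) (toℕ-fromℕ< x<9) (toℕ-fromℕ< (s≤s y≤6))
    (check (fromℕ< x<9) (fromℕ< (s≤s y≤6))) e
  where
  check : ∀ (i : Fin 9) (j : Fin 7) → PellSolution (toℕ i) (toℕ j) → toℕ i ≡ 3 × toℕ j ≡ 3
  check = toWitness {a? = all? λ i → all? λ j → (_ ≟ _) →-dec (toℕ i ≟ 3 ×-dec toℕ j ≟ 3)} _
  x<9 : x < 9
  x<9 = m*m<n*n⇒m<n (+-cancelʳ-< 9 (x * x) 81 (begin-strict
    x * x + 9    ≡⟨ e ⟩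
    2 * (y * y)  ≤⟨ *-monoʳ-≤ 2 (*-mono-≤ y≤6 y≤6) ⟩
    72           <⟨ m≤m+n 73 17 ⟩
    81 + 9       ∎))
    where open ≤-Reasoning

pell-step-inverse : ∀ {a b x y} → a + 4 * y ≡ 3 * x → b + 2 * x ≡ 3 * y →
  x ≡ 3 * a + 4 * b × y ≡ 2 * a + 3 * b
pell-step-inverse {a} {b} {x} {y} ex ey =
  sym (+-cancelʳ-≡ (8 * x + 12 * y) _ _ (begin
    3 * a + 4 * b + (8 * x + 12 * y)   ≡⟨ solve (a ∷ b ∷ x ∷ y ∷ []) ⟩
    3 * (a + 4 * y) + 4 * (b + 2 * x)  ≡⟨ cong₂ (λ p q → 3 * p + 4 * q) ex ey ⟩
    3 * (3 * x) + 4 * (3 * y)          ≡⟨ solve (x ∷ y ∷ []) ⟩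
    x + (8 * x + 12 * y)               ∎)) ,
  sym (+-cancelʳ-≡ (6 * x + 8 * y) _ _ (begin
    2 * a + 3 * b + (6 * x + 8 * y)    ≡⟨ solve (a ∷ b ∷ x ∷ y ∷ []) ⟩
    2 * (a + 4 * y) + 3 * (b + 2 * x)  ≡⟨ cong₂ (λ p q → 2 * p + 3 * q) ex ey ⟩
    2 * (3 * x) + 3 * (3 * y)          ≡⟨ solve (x ∷ y ∷ []) ⟩
    y + (6 * x + 8 * y)                ∎))
  where open ≡-Reasoning

pell-descent : ∀ {x y} → 7 ≤ y → PellSolution x y →
  ∃₂ λ a b → b < y × x ≡ 3 * a + 4 * b × y ≡ 2 * a + 3 * b
pell-descent {x} {y} 7≤y e = a , b , b<y , pell-step-inverse {a} {b} (m∸n+n≡m 4y≤3x) (m∸n+n≡m 2x≤3y)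
  where
  open ≤-Reasoning
  a b : ℕ
  a = 3 * x ∸ 4 * y
  b = 3 * y ∸ 2 * x
  49≤y*y : 49 ≤ y * y
  49≤y*y = *-mono-≤ 7≤y 7≤y
  4y≤3x : 4 * y ≤ 3 * x
  4y≤3x = m*m≤n*n⇒m≤n (+-cancelʳ-≤ 81 _ _ (begin
    4 * y * (4 * y) + 81           ≤⟨ +-monoʳ-≤ (4 * y * (4 * y)) (≤-trans (m≤m+n 81 17) (*-monoʳ-≤ 2 49≤y*y)) ⟩
    4 * y * (4 * y) + 2 * (y * y)  ≡⟨ solve (y ∷ []) ⟩
    9 * (2 * (y * y))              ≡⟨ cong (9 *_) e ⟨
    9 * (x * x + 9)                ≡⟨ solve (x ∷ []) ⟩
    3 * x * (3 * x) + 81           ∎))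
  2x≤3y : 2 * x ≤ 3 * y
  2x≤3y = m*m≤n*n⇒m≤n (begin
    2 * x * (2 * x)       ≤⟨ m≤m+n (2 * x * (2 * x)) 36 ⟩
    2 * x * (2 * x) + 36  ≡⟨ solve (x ∷ []) ⟩
    4 * (x * x + 9)       ≡⟨ cong (4 *_) e ⟩
    4 * (2 * (y * y))     ≤⟨ m≤m+n (4 * (2 * (y * y))) (y * y) ⟩
    4 * (2 * (y * y)) + y * y  ≡⟨ solve (y ∷ []) ⟩
    3 * y * (3 * y)       ∎)
  y<x : y < x
  y<x = m*m<n*n⇒m<n (+-cancelʳ-< 9 (y * y) (x * x) (begin-strict
    y * y + 9      <⟨ +-monoʳ-< (y * y) (≤-trans (m≤m+n 10 39) 49≤y*y) ⟩
    y * y + y * y  ≡⟨ solve (y ∷ []) ⟩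
    2 * (y * y)    ≡⟨ e ⟨
    x * x + 9      ∎))
  b<y : b < y
  b<y = +-cancelʳ-< (2 * x) b y (begin-strict
    b + 2 * x  ≡⟨ m∸n+n≡m 2x≤3y ⟩
    3 * y      ≡⟨ solve (y ∷ []) ⟩
    y + 2 * y  <⟨ +-monoʳ-< y (*-monoʳ-< 2 y<x) ⟩
    y + 2 * x  ∎)

IsPellTerm : ℕ → ℕ → Set
IsPellTerm x y = ∃ λ j → x ≡ pellX j × y ≡ pellY j

PellClassified : ℕ → Set
PellClassified y = ∀ {x} → PellSolution x y → IsPellTerm x y

pell-solutions : ∀ y → PellClassified y
pell-solutions = <-rec PellClassified solutions
  where
  descend : ∀ {x y} → (∃₂ λ a b → b < y × x ≡ 3 * a + 4 * b × y ≡ 2 * a + 3 * b) →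
            (∀ {z} → z < y → PellClassified z) → PellSolution x y → IsPellTerm x y
  descend (a , b , b<y , refl , refl) rec e =
    let j , a≡ , b≡ = rec b<y {a} (pellSolution-descends a b e)
    in suc j , cong₂ (λ p q → 3 * p + 4 * q) a≡ b≡ , cong₂ (λ p q → 2 * p + 3 * q) a≡ b≡
  solutions : ∀ y → (∀ {z} → z < y → PellClassified z) → PellClassified y
  solutions y rec {x} e with y ≤? 6
  ... | yes y≤6 = 0 , pellSolution-small y≤6 e
  ... | no y≰6  = descend (pell-descent (≰⇒> y≰6) e) rec e

-- The neo balcobalancing numbers

-- One step of (u, w) is two steps of the Pell map on (4 * neoB k − 3, neoC k).
u w : ℕ → ℕ
u zero    = 0
u (suc k) = suc (29 * u k + 12 * w k)
w zero    = 0
w (suc k) = 12 * u k + 5 * w k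

-- The paper's B_k and C_k for k ≥ 1 (nthNeoBC-unique, neoC-unique).
neoB neoC : ℕ → ℕ
neoB k = 6 * u k
neoC k = 12 * (u k + w k) + 3

-- C² = 8B² − 12B + 9 for B = 6U and C = 12(U + W) + 3, divided by 72.
Invariant : ℕ → ℕ → Set
Invariant U W = 2 * (U * U) ≡ (2 * W + 1) * (2 * U + W)

cancel-invariant : ∀ U W {m n} c → Invariant U W →
  m + c * ((2 * W + 1) * (2 * U + W)) ≡ n + c * (2 * (U * U)) → m ≡ n
cancel-invariant _ _ {n = n} c inv e = +-cancelʳ-≡ _ _ _ (trans e (cong (λ z → n + c * z) inv))

invariant-step : ∀ U W → Invariant U W → Invariant (suc (29 * U + 12 * W)) (12 * U + 5 * W)
invariant-step U W inv = cancel-invariant U W 1 inv (identity U W)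
  where
  identity : ∀ U W →
    2 * (suc (29 * U + 12 * W) * suc (29 * U + 12 * W)) + 1 * ((2 * W + 1) * (2 * U + W))
    ≡ (2 * (12 * U + 5 * W) + 1) * (2 * suc (29 * U + 12 * W) + (12 * U + 5 * W)) + 1 * (2 * (U * U))
  identity = solve-∀

invariant : ∀ k → Invariant (u k) (w k)
invariant zero    = refl
invariant (suc k) = invariant-step (u k) (w k) (invariant k)

neoC-square : ∀ k → neoC k * neoC k + 12 * neoB k ≡ 8 * neoB k * neoB k + 9
neoC-square k = square (u k) (w k) (invariant k)
  where
  square : ∀ U W → Invariant U W →
    (12 * (U + W) + 3) * (12 * (U + W) + 3) + 12 * (6 * U) ≡ 8 * (6 * U) * (6 * U) + 9
  square U W inv = sym (cancel-invariant U W 72 inv (identity U W))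
    where
    identity : ∀ U W →
      8 * (6 * U) * (6 * U) + 9 + 72 * ((2 * W + 1) * (2 * U + W))
      ≡ (12 * (U + W) + 3) * (12 * (U + W) + 3) + 12 * (6 * U) + 72 * (2 * (U * U))
    identity = solve-∀

pell-oddIndex : ∀ k → pellX (suc (k * 2)) + 3 ≡ 4 * neoB (suc k) × pellY (suc (k * 2)) ≡ neoC (suc k)
pell-oddIndex zero    = refl , refl
pell-oddIndex (suc k) =
  twoSteps (pellX (suc (k * 2))) (pellY (suc (k * 2))) (u (suc k)) (w (suc k)) (pell-oddIndex k)
  where
  twoSteps : ∀ X Y U W → X + 3 ≡ 4 * (6 * U) × Y ≡ 12 * (U + W) + 3 →
    3 * (3 * X + 4 * Y) + 4 * (2 * X + 3 * Y) + 3 ≡ 4 * (6 * suc (29 * U + 12 * W)) ×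
    2 * (3 * X + 4 * Y) + 3 * (2 * X + 3 * Y) ≡ 12 * (suc (29 * U + 12 * W) + (12 * U + 5 * W)) + 3
  twoSteps X _ U W (eX , refl) =
    +-cancelʳ-≡ 48 _ _ (begin
      3 * (3 * X + 4 * (12 * (U + W) + 3)) + 4 * (2 * X + 3 * (12 * (U + W) + 3)) + 3 + 48
        ≡⟨ solve (X ∷ U ∷ W ∷ []) ⟩
      17 * (X + 3) + 24 * (12 * (U + W) + 3)
        ≡⟨ cong (λ z → 17 * z + 24 * (12 * (U + W) + 3)) eX ⟩
      17 * (4 * (6 * U)) + 24 * (12 * (U + W) + 3)
        ≡⟨ solve (U ∷ W ∷ []) ⟩
      4 * (6 * suc (29 * U + 12 * W)) + 48 ∎) ,
    +-cancelʳ-≡ 36 _ _ (begin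
      2 * (3 * X + 4 * (12 * (U + W) + 3)) + 3 * (2 * X + 3 * (12 * (U + W) + 3)) + 36
        ≡⟨ solve (X ∷ U ∷ W ∷ []) ⟩
      12 * (X + 3) + 17 * (12 * (U + W) + 3)
        ≡⟨ cong (λ z → 12 * z + 17 * (12 * (U + W) + 3)) eX ⟩
      12 * (4 * (6 * U)) + 17 * (12 * (U + W) + 3)
        ≡⟨ solve (U ∷ W ∷ []) ⟩
      12 * (suc (29 * U + 12 * W) + (12 * U + 5 * W)) + 3 + 36 ∎)
    where open ≡-Reasoning

pellX-evenIndex : ∀ k → ∃ λ q → pellX (k * 2) ≡ q * 4 + 3
pellX-evenIndex zero    = 0 , refl
pellX-evenIndex (suc k) =
  30 * u (suc k) + 12 * w (suc k) ,
  oneStep (pellX (suc (k * 2))) (pellY (suc (k * 2))) (u (suc k)) (w (suc k)) (pell-oddIndex k)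
  where
  oneStep : ∀ X Y U W → X + 3 ≡ 4 * (6 * U) × Y ≡ 12 * (U + W) + 3 →
    3 * X + 4 * Y ≡ (30 * U + 12 * W) * 4 + 3
  oneStep X _ U W (eX , refl) = +-cancelʳ-≡ 9 _ _ (begin
    3 * X + 4 * (12 * (U + W) + 3) + 9         ≡⟨ solve (X ∷ U ∷ W ∷ []) ⟩
    3 * (X + 3) + 4 * (12 * (U + W) + 3)       ≡⟨ cong (λ z → 3 * z + 4 * (12 * (U + W) + 3)) eX ⟩
    3 * (4 * (6 * U)) + 4 * (12 * (U + W) + 3) ≡⟨ solve (U ∷ W ∷ []) ⟩
    (30 * U + 12 * W) * 4 + 3 + 9              ∎)
    where open ≡-Reasoning

invariant⇒neoBC : ∀ p W → Invariant (suc p) W → NeoBC (6 * suc p)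
invariant⇒neoBC p W inv = s≤s z≤n , suc (6 * W) , s≤s z≤n ,
  neoBC-equation⇐ (p + 5 * suc p) (suc (6 * W) + 2) (cancel-invariant (suc p) W 18 inv (identity p W))
  where
  identity : ∀ p W →
    suc (p + 5 * suc p) * suc (p + 5 * suc p) + (suc (6 * W) + 2) + 18 * ((2 * W + 1) * (2 * suc p + W))
    ≡ (suc (6 * W) + 2) * (2 * (p + 5 * suc p) + (suc (6 * W) + 2)) + 18 * (2 * (suc p * suc p))
  identity = solve-∀

neoB-isNeoBC : ∀ k → NeoBC (neoB (suc k))
neoB-isNeoBC k = invariant⇒neoBC (29 * u k + 12 * w k) (w (suc k)) (invariant (suc k))

-- (4M − 3, 2M + 2L − 3) for M = suc m and L = suc l.
neoBC-pell : ∀ m l → suc m * suc m + suc l ≡ suc l * (2 * m + suc l) →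
  PellSolution (m * 4 + 1) (2 * m + 2 * l + 1)
neoBC-pell m l e = +-cancelʳ-≡ (8 * (suc l * (2 * m + suc l))) _ _ (begin
  (m * 4 + 1) * (m * 4 + 1) + 9 + 8 * (suc l * (2 * m + suc l))
    ≡⟨ solve (m ∷ l ∷ []) ⟩
  2 * ((2 * m + 2 * l + 1) * (2 * m + 2 * l + 1)) + 8 * (suc m * suc m + suc l)
    ≡⟨ cong (λ z → 2 * ((2 * m + 2 * l + 1) * (2 * m + 2 * l + 1)) + 8 * z) e ⟩
  2 * ((2 * m + 2 * l + 1) * (2 * m + 2 * l + 1)) + 8 * (suc l * (2 * m + suc l)) ∎)
  where open ≡-Reasoning

pellX≡m*4+1⇒neoB : ∀ {m} j → m * 4 + 1 ≡ pellX j → ∃ λ k → suc m ≡ neoB (suc k)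
pellX≡m*4+1⇒neoB {m} j e with even⊎odd j
... | t , inj₁ refl = let q , eq = pellX-evenIndex t in ⊥-elim (m*4+1≢n*4+3 m q (trans e eq))
... | t , inj₂ refl = t , *-cancelˡ-≡ (suc m) (neoB (suc t)) 4 (begin
  4 * suc m                  ≡⟨ solve (m ∷ []) ⟩
  m * 4 + 1 + 3              ≡⟨ cong (_+ 3) e ⟩
  pellX (suc (t * 2)) + 3    ≡⟨ proj₁ (pell-oddIndex t) ⟩
  4 * neoB (suc t)           ∎)
  where open ≡-Reasoning

neoBC⇒neoB : ∀ {m} → NeoBC m → ∃ λ k → m ≡ neoB (suc k)
neoBC⇒neoB {suc m} (_ , suc s , _ , e) =
  let j , x≡ , _ = pell-solutions (2 * m + 2 * (s + 2) + 1)
                     (neoBC-pell m (s + 2) (neoBC-equation⇒ m (suc s + 2) e))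
  in pellX≡m*4+1⇒neoB j x≡

u-<-suc : ∀ k → u k < u (suc k)
u-<-suc k = s≤s (≤-trans (m≤n*m (u k) 29) (m≤m+n (29 * u k) (12 * w k)))

u-< : ∀ {i j} → i < j → u i < u j
u-< {i} {suc j} (s≤s i≤j) with m≤n⇒m<n∨m≡n i≤j
... | inj₁ i<j  = <-trans (u-< i<j) (u-<-suc j)
... | inj₂ refl = u-<-suc j

neoB-< : ∀ {i j} → i < j → neoB i < neoB j
neoB-< i<j = *-monoʳ-< 6 (u-< i<j)

neoB-cancel-< : ∀ {i j} → neoB i < neoB j → i < j
neoB-cancel-< {i} {j} lt with <-cmp i j
... | tri< i<j _ _  = i<j
... | tri≈ _ refl _ = ⊥-elim (<-irrefl refl lt)
... | tri> _ _ j<i  = ⊥-elim (<-asym lt (neoB-< j<i))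

nthNeoBC-neoB : ∀ k → NthNeoBC (suc k) (neoB (suc k))
nthNeoBC-neoB zero = first (neoB-isNeoBC 0) below
  where
  below : ∀ m → m < neoB 1 → ¬ NeoBC m
  below m m<B₁ isNeo with neoBC⇒neoB isNeo
  ... | k , refl = <⇒≱ (neoB-cancel-< {suc k} {1} m<B₁) (s≤s z≤n)
nthNeoBC-neoB (suc k) = next (nthNeoBC-neoB k) (neoB-< {suc k} ≤-refl) (neoB-isNeoBC (suc k)) between
  where
  between : ∀ m → neoB (suc k) < m → m < neoB (suc (suc k)) → ¬ NeoBC m
  between m lo hi isNeo with neoBC⇒neoB isNeo
  ... | i , refl = <⇒≱ (neoB-cancel-< {suc i} {suc (suc k)} hi) (neoB-cancel-< {suc k} {suc i} lo)

nthNeoBC-unique : ∀ {k m} → NthNeoBC k m → m ≡ neoB k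
nthNeoBC-unique (first isNeo below) with neoBC⇒neoB isNeo
... | zero  , e    = e
... | suc i , refl = ⊥-elim (below (neoB 1) (neoB-< {1} {suc (suc i)} (s≤s (s≤s z≤n))) (neoB-isNeoBC 0))
nthNeoBC-unique (next {k} previous lt isNeo between) with nthNeoBC-unique previous | neoBC⇒neoB isNeo
... | refl | i , refl with m≤n⇒m<n∨m≡n (≤-pred (neoB-cancel-< {k} {suc i} lt))
...   | inj₂ refl = refl
...   | inj₁ k<i  =
  ⊥-elim (between (neoB (suc k)) (neoB-< {k} ≤-refl) (neoB-< {suc k} {suc i} (s≤s k<i)) (neoB-isNeoBC k))

neoC-unique : ∀ {k C} → C * C ≡ 8 * neoB k * neoB k + 9 ∸ 12 * neoB k → C ≡ neoC k
neoC-unique {k} {C} e = m*m≡n*n⇒m≡n {C} {neoC k} (begin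
  C * C                                               ≡⟨ e ⟩
  8 * neoB k * neoB k + 9 ∸ 12 * neoB k               ≡⟨ cong (_∸ 12 * neoB k) (neoC-square k) ⟨
  neoC k * neoC k + 12 * neoB k ∸ 12 * neoB k         ≡⟨ m+n∸n≡m (neoC k * neoC k) (12 * neoB k) ⟩
  neoC k * neoC k                                     ∎)
  where open ≡-Reasoning

nthNeoBC-subst : ∀ {k} (P : ℕ → ℕ → Set) → P (neoB k) (neoC k) →
  ∀ B C → NthNeoBC k B → C * C ≡ 8 * B * B + 9 ∸ 12 * B → P B C
nthNeoBC-subst {k} P holds B C nthB root =
  subst₂ P (sym B≡) (sym (neoC-unique {k} {C} (subst (λ X → C * C ≡ 8 * X * X + 9 ∸ 12 * X) B≡ root))) holds
  where
  B≡ : B ≡ neoB k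
  B≡ = nthNeoBC-unique nthB

-- Pythagorean triples

pos[m]≡pos[m+n]-pos[n] : ∀ m n → + m ≡ + (m + n) - + n
pos[m]≡pos[m+n]-pos[n] m n = x≡x+y-y (+ m) (+ n)
  where
  x≡x+y-y : ∀ x y → x ≡ x ℤ.+ y - y
  x≡x+y-y = ℤ-Solver.solve-∀

m+n≡o⇒pos[m]≡pos[o]-pos[n] : ∀ {m n o} → m + n ≡ o → + m ≡ + o - + n
m+n≡o⇒pos[m]≡pos[o]-pos[n] {m} {n} refl = pos[m]≡pos[m+n]-pos[n] m n

pythagoreanTriple : ∀ {a b c} → 0 < a → 0 < b → 0 < c → a * a + b * b ≡ c * c →
  PythagoreanTriple (+ a) (+ b) (+ c)
pythagoreanTriple {a} {b} {c} 0<a 0<b 0<c e = ℤ.+<+ 0<a , ℤ.+<+ 0<b , ℤ.+<+ 0<c , (begin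
  + a ℤ.* + a ℤ.+ + b ℤ.* + b  ≡⟨ cong₂ ℤ._+_ (pos-* a a) (pos-* b b) ⟨
  + (a * a + b * b)            ≡⟨ cong +_ e ⟩
  + (c * c)                    ≡⟨ pos-* c c ⟩
  + c ℤ.* + c                  ∎)
  where open ≡-Reasoning

EvenTriple : ℕ → ℕ → Set
EvenTriple B C = PythagoreanQuot
  (+ 6) (+ 12 ℤ.* + B - + 4 ℤ.* + C - + 6)
  (+ 6) (+ 12 ℤ.* + B - + 4 ℤ.* + C - + 12)
  (+ 6) (+ 6 ℤ.* + C - + 16 ℤ.* + B ℤ.+ + 12)

even-triple : ∀ t → EvenTriple (neoB (suc (suc t))) (neoC (suc (suc t)))
even-triple t =
  + a , + b , + c , leg a 6 (leg-a p W) , leg b 12 (leg-b p W) , hypotenuse (hypotenuse-c p W) ,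
  pythagoreanTriple z<s z<s z<s (cancel-invariant (suc p) W 8 (invariant (suc t)) (squares p W))
  where
  open ≡-Reasoning
  -- u (suc t) = suc p, so each witness below is syntactically a successor and z<s proves it positive.
  p W : ℕ
  p = 29 * u t + 12 * w t
  W = w (suc t)
  a b c B C : ℕ
  a = suc (20 * suc p + 8 * W)
  b = 20 * suc p + 8 * W
  c = suc (28 * suc p + 12 * W)
  B = 6 * suc (29 * suc p + 12 * W)
  C = 12 * (suc (29 * suc p + 12 * W) + (12 * suc p + 5 * W)) + 3
  leg-a : ∀ p W →
    6 * suc (20 * suc p + 8 * W) + 6 + 4 * (12 * (suc (29 * suc p + 12 * W) + (12 * suc p + 5 * W)) + 3)
    ≡ 12 * (6 * suc (29 * suc p + 12 * W))
  leg-a = solve-∀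
  leg-b : ∀ p W →
    6 * (20 * suc p + 8 * W) + 12 + 4 * (12 * (suc (29 * suc p + 12 * W) + (12 * suc p + 5 * W)) + 3)
    ≡ 12 * (6 * suc (29 * suc p + 12 * W))
  leg-b = solve-∀
  hypotenuse-c : ∀ p W →
    6 * suc (28 * suc p + 12 * W) + 16 * (6 * suc (29 * suc p + 12 * W))
    ≡ 6 * (12 * (suc (29 * suc p + 12 * W) + (12 * suc p + 5 * W)) + 3) + 12
  hypotenuse-c = solve-∀
  squares : ∀ p W →
    suc (20 * suc p + 8 * W) * suc (20 * suc p + 8 * W) + (20 * suc p + 8 * W) * (20 * suc p + 8 * W)
    + 8 * ((2 * W + 1) * (2 * suc p + W))
    ≡ suc (28 * suc p + 12 * W) * suc (28 * suc p + 12 * W) + 8 * (2 * (suc p * suc p))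
  squares = solve-∀
  leg : ∀ x d → 6 * x + d + 4 * C ≡ 12 * B → + 6 ℤ.* + x ≡ + 12 ℤ.* + B - + 4 ℤ.* + C - + d
  leg x d e = begin
    + 6 ℤ.* + x                       ≡⟨ pos-* 6 x ⟨
    + (6 * x)                         ≡⟨ pos[m]≡pos[m+n]-pos[n] (6 * x) d ⟩
    + (6 * x + d) - + d               ≡⟨ cong (_- + d) (m+n≡o⇒pos[m]≡pos[o]-pos[n] {6 * x + d} {4 * C} e) ⟩
    + (12 * B) - + (4 * C) - + d      ≡⟨ cong₂ (λ y z → y - z - + d) (pos-* 12 B) (pos-* 4 C) ⟩
    + 12 ℤ.* + B - + 4 ℤ.* + C - + d  ∎
  hypotenuse : 6 * c + 16 * B ≡ 6 * C + 12 → + 6 ℤ.* + c ≡ + 6 ℤ.* + C - + 16 ℤ.* + B ℤ.+ + 12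
  hypotenuse e = begin
    + 6 ℤ.* + c                          ≡⟨ pos-* 6 c ⟨
    + (6 * c)                            ≡⟨ m+n≡o⇒pos[m]≡pos[o]-pos[n] {6 * c} {16 * B} e ⟩
    + (6 * C) ℤ.+ + 12 - + (16 * B)      ≡⟨ x+y-z≡x-z+y (+ (6 * C)) (+ 12) (+ (16 * B)) ⟩
    + (6 * C) - + (16 * B) ℤ.+ + 12      ≡⟨ cong₂ (λ y z → y - z ℤ.+ + 12) (pos-* 6 C) (pos-* 16 B) ⟩
    + 6 ℤ.* + C - + 16 ℤ.* + B ℤ.+ + 12  ∎
    where
    x+y-z≡x-z+y : ∀ x y z → x ℤ.+ y - z ≡ x - z ℤ.+ y
    x+y-z≡x-z+y = ℤ-Solver.solve-∀

OddTriple : ℕ → ℕ → ℕ → ℕ → Set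
OddTriple B₁ C₁ B₀ C₀ = PythagoreanQuot
  (+ 12) (+ 20 ℤ.* + B₁ ℤ.+ + 4 ℤ.* + B₀ - + 7 ℤ.* + C₁ - + C₀ - + 12)
  (+ 12) (+ 20 ℤ.* + B₁ ℤ.+ + 4 ℤ.* + B₀ - + 7 ℤ.* + C₁ - + C₀ - + 24)
  (+ 6) (+ 20 ℤ.* + B₁ - + 4 ℤ.* + B₀ - + 7 ℤ.* + C₁ ℤ.+ + C₀ - + 12)

odd-triple : ∀ t → OddTriple (neoB (suc (suc t))) (neoC (suc (suc t))) (neoB (suc t)) (neoC (suc t))
odd-triple t =
  + a , + b , + c , leg a 12 (leg-a p W) , leg b 24 (leg-b p W) , hypotenuse (hypotenuse-c p W) ,
  pythagoreanTriple z<s z<s z<s (cancel-invariant (suc p) W 8 (invariant (suc t)) (squares p W))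
  where
  open ≡-Reasoning
  p W : ℕ
  p = 29 * u t + 12 * w t
  W = w (suc t)
  a b c B₁ C₁ B₀ C₀ : ℕ
  a = 4 * suc p
  b = 3 + 4 * p
  c = suc (4 * suc p + 4 * W)
  B₁ = 6 * suc (29 * suc p + 12 * W)
  C₁ = 12 * (suc (29 * suc p + 12 * W) + (12 * suc p + 5 * W)) + 3
  B₀ = 6 * suc p
  C₀ = 12 * (suc p + W) + 3
  leg-a : ∀ p W →
    12 * (4 * suc p) + 12 + (12 * (suc p + W) + 3) + 7 * (12 * (suc (29 * suc p + 12 * W) + (12 * suc p + 5 * W)) + 3)
    ≡ 20 * (6 * suc (29 * suc p + 12 * W)) + 4 * (6 * suc p)
  leg-a = solve-∀
  leg-b : ∀ p W →
    12 * (3 + 4 * p) + 24 + (12 * (suc p + W) + 3) + 7 * (12 * (suc (29 * suc p + 12 * W) + (12 * suc p + 5 * W)) + 3)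
    ≡ 20 * (6 * suc (29 * suc p + 12 * W)) + 4 * (6 * suc p)
  leg-b = solve-∀
  hypotenuse-c : ∀ p W →
    6 * suc (4 * suc p + 4 * W) + 12 + 7 * (12 * (suc (29 * suc p + 12 * W) + (12 * suc p + 5 * W)) + 3) + 4 * (6 * suc p)
    ≡ 20 * (6 * suc (29 * suc p + 12 * W)) + (12 * (suc p + W) + 3)
  hypotenuse-c = solve-∀
  squares : ∀ p W →
    4 * suc p * (4 * suc p) + (3 + 4 * p) * (3 + 4 * p) + 8 * ((2 * W + 1) * (2 * suc p + W))
    ≡ suc (4 * suc p + 4 * W) * suc (4 * suc p + 4 * W) + 8 * (2 * (suc p * suc p))
  squares = solve-∀
  leg : ∀ x d → 12 * x + d + C₀ + 7 * C₁ ≡ 20 * B₁ + 4 * B₀ →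
        + 12 ℤ.* + x ≡ + 20 ℤ.* + B₁ ℤ.+ + 4 ℤ.* + B₀ - + 7 ℤ.* + C₁ - + C₀ - + d
  leg x d e = begin
    + 12 ℤ.* + x
      ≡⟨ pos-* 12 x ⟨
    + (12 * x)
      ≡⟨ pos[m]≡pos[m+n]-pos[n] (12 * x) d ⟩
    + (12 * x + d) - + d
      ≡⟨ cong (_- + d) (pos[m]≡pos[m+n]-pos[n] (12 * x + d) C₀) ⟩
    + (12 * x + d + C₀) - + C₀ - + d
      ≡⟨ cong (λ y → y - + C₀ - + d) (m+n≡o⇒pos[m]≡pos[o]-pos[n] {12 * x + d + C₀} {7 * C₁} e) ⟩
    + (20 * B₁) ℤ.+ + (4 * B₀) - + (7 * C₁) - + C₀ - + d
      ≡⟨ cong₂ (λ y z → y ℤ.+ z - + (7 * C₁) - + C₀ - + d) (pos-* 20 B₁) (pos-* 4 B₀) ⟩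
    + 20 ℤ.* + B₁ ℤ.+ + 4 ℤ.* + B₀ - + (7 * C₁) - + C₀ - + d
      ≡⟨ cong (λ y → + 20 ℤ.* + B₁ ℤ.+ + 4 ℤ.* + B₀ - y - + C₀ - + d) (pos-* 7 C₁) ⟩
    + 20 ℤ.* + B₁ ℤ.+ + 4 ℤ.* + B₀ - + 7 ℤ.* + C₁ - + C₀ - + d
      ∎
  hypotenuse : 6 * c + 12 + 7 * C₁ + 4 * B₀ ≡ 20 * B₁ + C₀ →
               + 6 ℤ.* + c ≡ + 20 ℤ.* + B₁ - + 4 ℤ.* + B₀ - + 7 ℤ.* + C₁ ℤ.+ + C₀ - + 12
  hypotenuse e = begin
    + 6 ℤ.* + c
      ≡⟨ pos-* 6 c ⟨
    + (6 * c)
      ≡⟨ pos[m]≡pos[m+n]-pos[n] (6 * c) 12 ⟩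
    + (6 * c + 12) - + 12
      ≡⟨ cong (_- + 12) (pos[m]≡pos[m+n]-pos[n] (6 * c + 12) (7 * C₁)) ⟩
    + (6 * c + 12 + 7 * C₁) - + (7 * C₁) - + 12
      ≡⟨ cong (λ y → y - + (7 * C₁) - + 12)
              (m+n≡o⇒pos[m]≡pos[o]-pos[n] {6 * c + 12 + 7 * C₁} {4 * B₀} e) ⟩
    + (20 * B₁) ℤ.+ + C₀ - + (4 * B₀) - + (7 * C₁) - + 12
      ≡⟨ regroup (+ (20 * B₁)) (+ C₀) (+ (4 * B₀)) (+ (7 * C₁)) (+ 12) ⟩
    + (20 * B₁) - + (4 * B₀) - + (7 * C₁) ℤ.+ + C₀ - + 12
      ≡⟨ cong₂ (λ y z → y - z - + (7 * C₁) ℤ.+ + C₀ - + 12) (pos-* 20 B₁) (pos-* 4 B₀) ⟩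
    + 20 ℤ.* + B₁ - + 4 ℤ.* + B₀ - + (7 * C₁) ℤ.+ + C₀ - + 12
      ≡⟨ cong (λ y → + 20 ℤ.* + B₁ - + 4 ℤ.* + B₀ - y ℤ.+ + C₀ - + 12) (pos-* 7 C₁) ⟩
    + 20 ℤ.* + B₁ - + 4 ℤ.* + B₀ - + 7 ℤ.* + C₁ ℤ.+ + C₀ - + 12
      ∎
    where
    regroup : ∀ v w x y z → v ℤ.+ w - x - y - z ≡ v - x - y ℤ.+ w - z
    regroup = ℤ-Solver.solve-∀

EvenClaim : ℕ → Set
EvenClaim k = (∃ λ B → NthNeoBC k B)
  × (∀ B C → NthNeoBC k B → C * C ≡ 8 * B * B + 9 ∸ 12 * B → EvenTriple B C)

OddClaim : ℕ → ℕ → Set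
OddClaim k₁ k₀ = (∃ λ B → NthNeoBC k₁ B) × (∃ λ B → NthNeoBC k₀ B)
  × (∀ B₁ C₁ B₀ C₀ → NthNeoBC k₁ B₁ → C₁ * C₁ ≡ 8 * B₁ * B₁ + 9 ∸ 12 * B₁ →
       NthNeoBC k₀ B₀ → C₀ * C₀ ≡ 8 * B₀ * B₀ + 9 ∸ 12 * B₀ → OddTriple B₁ C₁ B₀ C₀)

even-claim : ∀ t → EvenClaim (suc (suc t))
even-claim t = (_ , nthNeoBC-neoB (suc t)) ,
  nthNeoBC-subst EvenTriple (even-triple t)

odd-claim : ∀ t → OddClaim (suc (suc t)) (suc t)
odd-claim t = (_ , nthNeoBC-neoB (suc t)) , (_ , nthNeoBC-neoB t) ,
  λ B₁ C₁ B₀ C₀ nth₁ root₁ → nthNeoBC-subst (OddTriple B₁ C₁)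
    (nthNeoBC-subst (λ X Y → OddTriple X Y (neoB (suc t)) (neoC (suc t)))
      (odd-triple t) B₁ C₁ nth₁ root₁) B₀ C₀

m≡n*2⇒m/2≡n : ∀ {m n} → m ≡ n * 2 → m / 2 ≡ n
m≡n*2⇒m/2≡n {n = n} refl = m*n/n≡m n 2

even-case : ∀ n → 2 ≤ n → 2 ∣ n → EvenClaim ((n + 2) / 2)
even-case _ ()  (divides zero refl)
even-case _ _   (divides (suc t) refl) = subst EvenClaim (sym (m≡n*2⇒m/2≡n (+-comm (suc t * 2) 2))) (even-claim t)

odd-case : ∀ n → 1 ≤ n → ¬ (2 ∣ n) → OddClaim ((n + 3) / 2) ((n + 1) / 2)
odd-case n _ 2∤n with even⊎odd n
... | t , inj₁ refl = ⊥-elim (2∤n (divides t refl))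
... | t , inj₂ refl = subst₂ OddClaim (sym (m≡n*2⇒m/2≡n (cong suc (+-comm (t * 2) 3))))
                                      (sym (m≡n*2⇒m/2≡n (cong suc (+-comm (t * 2) 1)))) (odd-claim t)

theorem7p1 :
    ((n : ℕ) → 2 ≤ n → 2 ∣ n →
      (∃ λ B → NthNeoBC ((n + 2) / 2) B)
      × (∀ B C → NthNeoBC ((n + 2) / 2) B → C * C ≡ 8 * B * B + 9 ∸ 12 * B →
          PythagoreanQuot
            (+ 6) (+ 12 ℤ.* + B - + 4 ℤ.* + C - + 6)
            (+ 6) (+ 12 ℤ.* + B - + 4 ℤ.* + C - + 12)
            (+ 6) (+ 6 ℤ.* + C - + 16 ℤ.* + B ℤ.+ + 12)))
    × ((n : ℕ) → 1 ≤ n → ¬ (2 ∣ n) →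
      (∃ λ B → NthNeoBC ((n + 3) / 2) B) × (∃ λ B → NthNeoBC ((n + 1) / 2) B)
      × (∀ B₁ C₁ B₀ C₀ →
          NthNeoBC ((n + 3) / 2) B₁ → C₁ * C₁ ≡ 8 * B₁ * B₁ + 9 ∸ 12 * B₁ →
          NthNeoBC ((n + 1) / 2) B₀ → C₀ * C₀ ≡ 8 * B₀ * B₀ + 9 ∸ 12 * B₀ →
          PythagoreanQuot
            (+ 12) (+ 20 ℤ.* + B₁ ℤ.+ + 4 ℤ.* + B₀ - + 7 ℤ.* + C₁ - + C₀ - + 12)
            (+ 12) (+ 20 ℤ.* + B₁ ℤ.+ + 4 ℤ.* + B₀ - + 7 ℤ.* + C₁ - + C₀ - + 24)
            (+ 6) (+ 20 ℤ.* + B₁ - + 4 ℤ.* + B₀ - + 7 ℤ.* + C₁ ℤ.+ + C₀ - + 12)))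
theorem7p1 = even-case , odd-case
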